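{- Let $G$ be a graph and suppose that $u_{ -k}u_{ -k+1}\dots u_k$ is a path in $G$ which is not $L$-good but each of whose subpaths of length $k$ is $L$-good. Then, provided that $L$ is sufficiently large compared to $|V(H)|$ (and $k$), there exist $1\leq \alpha,\beta\leq k$ with $\alpha+\beta> k$ such that there exist $(|V(H)|+2)(2k+1)+1$ pairwise internally vertex-disjoint paths of length $\alpha+\beta$ in $G$ between $u_{ -\alpha}$ and $u_{\beta}$.
   Context: Fix an integer $k\ge1$, a multigraph $F$ and $H=F^{2k-1}$ (the graph obtained from $F$ by replacing its edges with pairwise internally vertex-disjoint paths of length $2k$). For a positive real $L$ let $f(\ell,L)=L^{5^\ell}$ for $1\leq \ell\leq 2k$. $L$-admissible and $L$-good paths of length $\ell$ ($1\le\ell\le 2k$) are defined recursively: any path of length $1$ is both; for $2\leq \ell\leq 2k$, a path $v_0v_1\dots v_\ell$ is $L$-admissible if every proper subpath $v_i\dots v_j$, $(i,j)\neq(0,\ell)$, is $L$-good, and it is $L$-good if it is $L$-admissible and the number of $L$-admissible paths of length $\ell$ between $v_0$ and $v_\ell$ is at most $f(\ell,L)$.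
   Formalization: The parameter L of L-admissible and L-good paths ranges over the positive rationals rather than the positive reals. -}

module Defs where

open import Data.Nat as ℕ using (ℕ; zero; suc; _+_; _∸_; _≡ᵇ_)
open import Data.Fin using (Fin)
import Data.Fin as Fin
open import Data.Bool using (Bool; true; false; _∧_; not; if_then_else_; T)
open import Data.List using (List; []; _∷_; _++_; [_]; length; map; concatMap; upTo; take; drop; filterᵇ)
open import Data.Integer using (+_)
open import Data.Rational using (ℚ; _≤ᵇ_; _*_; 1ℚ; _/_)
open import Relation.Nullary.Decidable using (⌊_⌋)
open import Relation.Binary.PropositionalEquality using (_≡_)

record Graph (n : ℕ) : Set where
  field
    Adj   : Fin n → Fin n → Bool
    sym   : ∀ x y → Adj x y ≡ Adj y x
    irrefl : ∀ x → T (not (Adj x x))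

open Graph public

allB : {A : Set} → (A → Bool) → List A → Bool
allB P []      = true
allB P (x ∷ r) = P x ∧ allB P r

module _ {n : ℕ} (G : Graph n) where

  adjChain : List (Fin n) → Bool
  adjChain []           = true
  adjChain (x ∷ [])     = true
  adjChain (x ∷ y ∷ r)  = Adj G x y ∧ adjChain (y ∷ r)

  notIn : Fin n → List (Fin n) → Bool
  notIn x ys = allB (λ y → not ⌊ x Fin.≟ y ⌋) ys

  distinct : List (Fin n) → Bool
  distinct []      = true
  distinct (x ∷ r) = notIn x r ∧ distinct r

  nonempty : List (Fin n) → Bool
  nonempty []      = false
  nonempty (_ ∷ _) = true

  isPathB : List (Fin n) → Bool
  isPathB p = nonempty p ∧ adjChain p ∧ distinct p

  IsPath : List (Fin n) → Set
  IsPath p = T (isPathB p)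

plen : {A : Set} → List A → ℕ
plen p = length p ∸ 1

subpath : {A : Set} → ℕ → ℕ → List A → List A
subpath i j p = take (suc (j ∸ i)) (drop i p)

properSubpaths : {A : Set} → List A → List (List A)
properSubpaths p =
  concatMap (λ i →
    map (λ j → subpath i j p)
      (filterᵇ (λ j → not ((i ≡ᵇ 0) ∧ (j ≡ᵇ ℓ)))
        (map (λ d → i + suc d) (upTo (ℓ ∸ i)))))
    (upTo (suc ℓ))
  where ℓ = plen p

seqs : (n m : ℕ) → List (List (Fin n))
seqs n zero    = [] ∷ []
seqs n (suc m) = concatMap (λ x → map (x ∷_) (seqs n m)) (Data.List.allFin n)

lastOr : {A : Set} → A → List A → A
lastOr x []      = x
lastOr x (y ∷ r) = lastOr y r

sameEnds : {n : ℕ} → List (Fin n) → List (List (Fin n))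
sameEnds {n} []      = []
sameEnds {n} (x ∷ r) = map (λ mid → x ∷ mid ++ [ lastOr x r ]) (seqs n (plen (x ∷ r) ∸ 1))

count : {A : Set} → (A → Bool) → List A → ℕ
count P xs = length (filterᵇ P xs)

_^ℚ_ : ℚ → ℕ → ℚ
q ^ℚ zero  = 1ℚ
q ^ℚ suc m = q * (q ^ℚ m)

fbound : ℕ → ℚ → ℚ
fbound ℓ L = L ^ℚ (5 ℕ.^ ℓ)

toℚ : ℕ → ℚ
toℚ c = (+ c) / 1

-- L-admissible / L-good, by recursion with a fuel parameter (fuel ≥ ℓ - 1 for
-- admissibility and ≥ ℓ for goodness of a path of length ℓ suffices; every
-- recursive call is on a path of strictly smaller length).
module _ {n : ℕ} (G : Graph n) (L : ℚ) where

  mutual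
    admF : ℕ → List (Fin n) → Bool
    admF f p = isPathB G p ∧ allB (goodF f) (properSubpaths p)

    goodF : ℕ → List (Fin n) → Bool
    goodF zero    p = false
    goodF (suc f) p =
      if plen p ≡ᵇ 1
        then isPathB G p
        else (admF f p ∧ (toℚ (count (admF f) (sameEnds p)) ≤ᵇ fbound (plen p) L))

  IsAdmissible : List (Fin n) → Set
  IsAdmissible p = T (admF (plen p ∸ 1) p)

  IsGood : List (Fin n) → Set
  IsGood p = T (goodF (plen p) p)

-- If L is large enough, then for some 1 ≤ α, β ≤ k with
-- α + β > k the vertices u₋α and u_β are joined by (h+2)(2k+1)+1 paths of length
-- α + β with pairwise disjoint interiors.  (Formally the path is u 0 … u (2k), so
-- u₋α is u (k ∸ α) and u_β is u (k + β).)
--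
-- Write  window a d  for the subpath u a … u (a + d).
--  * Minimal bad window.  Passing repeatedly from a non-good window to a non-good
--    proper subwindow we reach a window of length d that is admissible but not
--    good: more than f(d,L) admissible paths of length d join its ends x and y.
--    Windows of length ≤ k are good (they lie inside good k-windows), so d > k.
--  * Splitting bound.  If v is the i-th interior vertex of an admissible x–y
--    path, its pieces x … v and v … y are proper subpaths, hence good; so at most
--    f(i+1,L) · f(d-i-1,L) ≤ L^(5^d - 1) admissible x–y paths have v at place i.
--  * Greedy packing.  Collect greedily admissible x–y paths with pairwise disjoint
--    interiors.  If m = (h+2)(2k+1)+1 of them are found we are done with α = k - a,
--    β = a + d - k.  Otherwise their interiors give at most C = (m-1)·2k·2k
--    pairs (vertex, place) meeting every admissible x–y path, so by the splitting
--    bound there are at most C · L^(5^d - 1) ≤ f(d,L) of them once L ≥ C: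
--    a contradiction.  Hence L₀ = C + 1 works.
module Submission where

open import Defs hiding (sym)
open import Data.Nat as ℕ using (ℕ; zero; suc; _+_; _*_; _∸_; _≤_; _<_; z≤n; s≤s; _≡ᵇ_; _^_; _≤?_; _<?_)
import Data.Nat.Properties as ℕₚ
open import Data.Nat.ListAction using (sum)
open import Data.Bool using (Bool; true; false; _∧_; not; T; if_then_else_; T?)
open import Data.Fin as Fin using (Fin)
import Data.Fin.Properties as Finₚ
import Data.Integer as ℤ
import Data.Integer.Properties as ℤₚ
open import Data.Nat.Coprimality using (Coprime)
open import Data.Nat.Divisibility using (∣1⇒≡1)
open import Data.Rational as ℚ using (ℚ; mkℚ; 0ℚ; 1ℚ; _/_; *≤*; nonNegative)
  renaming (_≤_ to _≤ℚ_; _<_ to _<ℚ_; _*_ to _*ℚ_; _+_ to _+ℚ_)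
import Data.Rational.Properties as ℚₚ
open import Data.List using (List; []; _∷_; _++_; [_]; map; length; filterᵇ; concat; concatMap;
  take; drop; upTo; applyUpTo; allFin; tabulate; lookup; cartesianProduct)
import Data.List.Properties as Listₚ
open import Data.List.Relation.Unary.Any using (Any; here; there; any?) renaming (map to Any-map)
open import Data.List.Relation.Unary.All as All using (All)
open import Data.List.Relation.Unary.AllPairs using (AllPairs; []; _∷_)
open import Data.List.Relation.Binary.Disjoint.Propositional using (Disjoint)
open import Data.List.Membership.Propositional using (_∈_; find; lose)
import Data.List.Membership.Propositional.Properties as ∈ₚ
open import Data.Product using (Σ; ∃-syntax; _×_; _,_; proj₁; proj₂)
open import Data.Sum using (_⊎_; inj₁; inj₂; map₂)
open import Data.Empty using (⊥; ⊥-elim)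
open import Data.Unit using (tt)
open import Relation.Nullary using (¬_; Dec; yes; no)
open import Relation.Unary using (Decidable)
open import Relation.Binary.Definitions using (DecidableEquality)
open import Relation.Nullary.Decidable using (⌊_⌋)
open import Relation.Binary.PropositionalEquality
  using (_≡_; _≢_; refl; sym; trans; cong; cong₂; subst; subst₂; module ≡-Reasoning)
open import Data.Nat.Solver using (module +-*-Solver)
open import Algebra.Properties.CommutativeSemigroup ℕₚ.+-commutativeSemigroup using (interchange)

∧-fst : ∀ {a b} → T (a ∧ b) → T a
∧-fst {true} _ = tt

∧-snd : ∀ {a b} → T (a ∧ b) → T b
∧-snd {true} t = t

∧-pair : ∀ {a b} → T a → T b → T (a ∧ b)
∧-pair {true} _ t = t

≢⇒≢ᵇ : ∀ m n → m ≢ n → T (not (m ≡ᵇ n))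
≢⇒≢ᵇ m n m≢n with m ≡ᵇ n in eq
... | true  = m≢n (ℕₚ.≡ᵇ⇒≡ m n (subst T (sym eq) tt))
... | false = tt

≢ᵇ⇒≢ : ∀ m n → T (not (m ≡ᵇ n)) → m ≢ n
≢ᵇ⇒≢ m n m≢ᵇn m≡n with m ≡ᵇ n | ℕₚ.≡⇒≡ᵇ m n m≡n
... | true  | _  = m≢ᵇn
... | false | ()

module _ {A : Set} where

  allB-ext : ∀ (P Q : A → Bool) xs → (∀ x → x ∈ xs → P x ≡ Q x) → allB P xs ≡ allB Q xs
  allB-ext P Q []       eq = refl
  allB-ext P Q (x ∷ xs) eq = cong₂ _∧_ (eq x (here refl)) (allB-ext P Q xs (λ y y∈ → eq y (there y∈)))

  allB-elem : ∀ (P : A → Bool) xs {x} → T (allB P xs) → x ∈ xs → T (P x)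
  allB-elem P (y ∷ xs) t (here refl) = ∧-fst t
  allB-elem P (y ∷ xs) t (there x∈) = allB-elem P xs (∧-snd {P y} t) x∈

  allB-counterexample : ∀ (P : A → Bool) xs → ¬ T (allB P xs) → ∃[ x ] (x ∈ xs × ¬ T (P x))
  allB-counterexample P []       fails = ⊥-elim (fails tt)
  allB-counterexample P (x ∷ xs) fails with P x in eq
  ... | false = x , here refl , subst T eq
  ... | true  with allB-counterexample P xs fails
  ... | y , y∈ , ¬Py = y , there y∈ , ¬Py

bit : Bool → ℕ
bit true  = 1
bit false = 0

module _ {A : Set} where

  count-∷ : ∀ (P : A → Bool) x xs → count P (x ∷ xs) ≡ bit (P x) + count P xs
  count-∷ P x xs with P x
  ... | true  = refl
  ... | false = refl

  count-mono : ∀ (P Q : A → Bool) xs → (∀ x → x ∈ xs → T (P x) → T (Q x)) → count P xs ≤ count Q xs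
  count-mono P Q []       P⇒Q = z≤n
  count-mono P Q (x ∷ xs) P⇒Q rewrite count-∷ P x xs | count-∷ Q x xs with P x in eqP | Q x in eqQ
  ... | true  | true  = s≤s rest
    where rest = count-mono P Q xs (λ y y∈ → P⇒Q y (there y∈))
  ... | true  | false = ⊥-elim (subst T eqQ (P⇒Q x (here refl) (subst T (sym eqP) tt)))
  ... | false | true  = ℕₚ.m≤n⇒m≤1+n (count-mono P Q xs (λ y y∈ → P⇒Q y (there y∈)))
  ... | false | false = count-mono P Q xs (λ y y∈ → P⇒Q y (there y∈))

  count-ext : ∀ (P Q : A → Bool) xs → (∀ x → x ∈ xs → P x ≡ Q x) → count P xs ≡ count Q xs
  count-ext P Q []       eq = refl
  count-ext P Q (x ∷ xs) eq rewrite count-∷ P x xs | count-∷ Q x xs | eq x (here refl) =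
    cong (bit (Q x) +_) (count-ext P Q xs (λ y y∈ → eq y (there y∈)))

  count≤length : ∀ (P : A → Bool) xs → count P xs ≤ length xs
  count≤length P []       = z≤n
  count≤length P (x ∷ xs) rewrite count-∷ P x xs with P x
  ... | true  = s≤s (count≤length P xs)
  ... | false = ℕₚ.m≤n⇒m≤1+n (count≤length P xs)

  count-++ : ∀ (P : A → Bool) xs ys → count P (xs ++ ys) ≡ count P xs + count P ys
  count-++ P []       ys = refl
  count-++ P (x ∷ xs) ys rewrite count-∷ P x (xs ++ ys) | count-∷ P x xs =
    trans (cong (bit (P x) +_) (count-++ P xs ys)) (sym (ℕₚ.+-assoc (bit (P x)) _ _))

  count-witness : ∀ (P : A → Bool) xs → 0 < count P xs → ∃[ x ] (x ∈ xs × T (P x))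
  count-witness P []       ()
  count-witness P (x ∷ xs) pos rewrite count-∷ P x xs with P x in eq
  ... | true  = x , here refl , subst T (sym eq) tt
  ... | false with count-witness P xs pos
  ... | y , y∈ , Py = y , there y∈ , Py

  count-none : ∀ (P : A → Bool) xs → (∀ x → x ∈ xs → ¬ T (P x)) → count P xs ≡ 0
  count-none P []       none = refl
  count-none P (x ∷ xs) none rewrite count-∷ P x xs with P x in eq
  ... | true  = ⊥-elim (none x (here refl) (subst T (sym eq) tt))
  ... | false = count-none P xs (λ y y∈ → none y (there y∈))

module _ {A B : Set} where

  count-map : ∀ (P : B → Bool) (f : A → B) xs → count P (map f xs) ≡ count (λ x → P (f x)) xs
  count-map P f []       = refl
  count-map P f (x ∷ xs) rewrite count-∷ P (f x) (map f xs) | count-∷ (λ x → P (f x)) x xs =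
    cong (bit (P (f x)) +_) (count-map P f xs)

  count-concatMap : ∀ (P : B → Bool) (f : A → List B) xs →
    count P (concatMap f xs) ≡ sum (map (λ x → count P (f x)) xs)
  count-concatMap P f []       = refl
  count-concatMap P f (x ∷ xs) =
    trans (count-++ P (f x) (concatMap f xs)) (cong (count P (f x) +_) (count-concatMap P f xs))

module _ {A : Set} where

  sum-cong : ∀ (f g : A → ℕ) xs → (∀ x → f x ≡ g x) → sum (map f xs) ≡ sum (map g xs)
  sum-cong f g xs f≡g = cong sum (Listₚ.map-cong f≡g xs)

  sum-+ : ∀ (f g : A → ℕ) xs → sum (map (λ x → f x + g x) xs) ≡ sum (map f xs) + sum (map g xs)
  sum-+ f g []       = refl
  sum-+ f g (x ∷ xs) rewrite sum-+ f g xs = interchange (f x) (g x) (sum (map f xs)) (sum (map g xs))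

  sum-*ʳ : ∀ (f : A → ℕ) c xs → sum (map (λ x → f x * c) xs) ≡ sum (map f xs) * c
  sum-*ʳ f c []       = refl
  sum-*ʳ f c (x ∷ xs) =
    trans (cong (f x * c +_) (sum-*ʳ f c xs)) (sym (ℕₚ.*-distribʳ-+ c (f x) (sum (map f xs))))

  bit≤sum : ∀ (Q : A → Bool) S → Any (λ b → T (Q b)) S → 1 ≤ sum (map (λ b → bit (Q b)) S)
  bit≤sum Q (b ∷ S) (here Qb) with Q b
  ... | true = s≤s z≤n
  bit≤sum Q (b ∷ S) (there QS) = ℕₚ.≤-trans (bit≤sum Q S QS) (ℕₚ.m≤n+m _ (bit (Q b)))

module _ {A B : Set} where

  union-bound : ∀ (P : A → Bool) (Q : B → A → Bool) (S : List B) xs →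
    (∀ x → x ∈ xs → T (P x) → Any (λ b → T (Q b x)) S) →
    count P xs ≤ sum (map (λ b → count (λ x → P x ∧ Q b x) xs) S)
  union-bound P Q S []       covered = z≤n
  union-bound P Q S (x ∷ xs) covered rewrite count-∷ P x xs = begin
    bit (P x) + count P xs
      ≤⟨ ℕₚ.+-mono-≤ head (union-bound P Q S xs (λ y y∈ → covered y (there y∈))) ⟩
    sum (map (λ b → bit (P x ∧ Q b x)) S) + sum (map (λ b → count (λ x → P x ∧ Q b x) xs) S)
      ≡⟨ sym (sum-+ (λ b → bit (P x ∧ Q b x)) (λ b → count (λ x → P x ∧ Q b x) xs) S) ⟩
    sum (map (λ b → bit (P x ∧ Q b x) + count (λ x → P x ∧ Q b x) xs) S)
      ≡⟨ sum-cong _ _ S (λ b → sym (count-∷ (λ x → P x ∧ Q b x) x xs)) ⟩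
    sum (map (λ b → count (λ x → P x ∧ Q b x) (x ∷ xs)) S) ∎
    where
    open ℕₚ.≤-Reasoning
    head : bit (P x) ≤ sum (map (λ b → bit (P x ∧ Q b x)) S)
    head with P x in eq
    ... | false = z≤n
    ... | true  = bit≤sum (λ b → Q b x) S (covered x (here refl) (subst T (sym eq) tt))

toℚ-coprime : ∀ c → Coprime c 1
toℚ-coprime c (_ , d∣1) = ∣1⇒≡1 d∣1

toℚ≡mkℚ : ∀ c → toℚ c ≡ mkℚ (ℤ.+ c) 0 (toℚ-coprime c)
toℚ≡mkℚ c = ℚₚ.normalize-coprime (toℚ-coprime c)

toℚ-+ : ∀ a b → toℚ (a + b) ≡ toℚ a +ℚ toℚ b
toℚ-+ a b rewrite toℚ≡mkℚ a | toℚ≡mkℚ b =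
  cong (_/ 1) (trans (ℤₚ.pos-+ a b) (sym (cong₂ ℤ._+_ (ℤₚ.*-identityʳ (ℤ.+ a)) (ℤₚ.*-identityʳ (ℤ.+ b)))))

toℚ-* : ∀ a b → toℚ (a * b) ≡ toℚ a *ℚ toℚ b
toℚ-* a b rewrite toℚ≡mkℚ a | toℚ≡mkℚ b = cong (_/ 1) (ℤₚ.pos-* a b)

toℚ-mono : ∀ {a b} → a ≤ b → toℚ a ≤ℚ toℚ b
toℚ-mono {a} {b} a≤b rewrite toℚ≡mkℚ a | toℚ≡mkℚ b =
  *≤* (subst₂ ℤ._≤_ (sym (ℤₚ.*-identityʳ (ℤ.+ a))) (sym (ℤₚ.*-identityʳ (ℤ.+ b))) (ℤ.+≤+ a≤b))

toℚ-nonNeg : ∀ c → 0ℚ ≤ℚ toℚ c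
toℚ-nonNeg c = toℚ-mono {0} {c} z≤n

sum-boundℚ : ∀ {A : Set} (h : A → ℕ) (B : ℚ) xs → (∀ x → x ∈ xs → toℚ (h x) ≤ℚ B) →
  toℚ (sum (map h xs)) ≤ℚ toℚ (length xs) *ℚ B
sum-boundℚ h B []       bounded = ℚₚ.≤-reflexive (sym (ℚₚ.*-zeroˡ B))
sum-boundℚ h B (x ∷ xs) bounded = begin
  toℚ (h x + sum (map h xs))           ≡⟨ toℚ-+ (h x) _ ⟩
  toℚ (h x) +ℚ toℚ (sum (map h xs))    ≤⟨ ℚₚ.+-mono-≤ (bounded x (here refl))
                                            (sum-boundℚ h B xs (λ y y∈ → bounded y (there y∈))) ⟩
  B +ℚ toℚ (length xs) *ℚ B            ≡⟨ cong (_+ℚ toℚ (length xs) *ℚ B) (sym (ℚₚ.*-identityˡ B)) ⟩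
  1ℚ *ℚ B +ℚ toℚ (length xs) *ℚ B      ≡⟨ sym (ℚₚ.*-distribʳ-+ B 1ℚ (toℚ (length xs))) ⟩
  (1ℚ +ℚ toℚ (length xs)) *ℚ B         ≡⟨ cong (_*ℚ B) (sym (toℚ-+ 1 (length xs))) ⟩
  toℚ (length (x ∷ xs)) *ℚ B           ∎
  where open ℚₚ.≤-Reasoning

^ℚ-+ : ∀ L a b → (L ^ℚ a) *ℚ (L ^ℚ b) ≡ L ^ℚ (a + b)
^ℚ-+ L zero    b = ℚₚ.*-identityˡ _
^ℚ-+ L (suc a) b = trans (ℚₚ.*-assoc L (L ^ℚ a) (L ^ℚ b)) (cong (L *ℚ_) (^ℚ-+ L a b))

module Powers (L : ℚ) (1≤L : 1ℚ ≤ℚ L) where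

  0≤L : 0ℚ ≤ℚ L
  0≤L = ℚₚ.≤-trans (toℚ-nonNeg 1) 1≤L

  ^ℚ-≥1 : ∀ a → 1ℚ ≤ℚ L ^ℚ a
  ^ℚ-≥1 zero    = ℚₚ.≤-refl
  ^ℚ-≥1 (suc a) = begin
    1ℚ              ≤⟨ 1≤L ⟩
    L               ≡⟨ sym (ℚₚ.*-identityʳ L) ⟩
    L *ℚ 1ℚ         ≤⟨ ℚₚ.*-monoˡ-≤-nonNeg L {{nonNegative 0≤L}} (^ℚ-≥1 a) ⟩
    L *ℚ (L ^ℚ a)   ∎
    where open ℚₚ.≤-Reasoning

  ^ℚ-nonNeg : ∀ a → 0ℚ ≤ℚ L ^ℚ a
  ^ℚ-nonNeg a = ℚₚ.≤-trans (toℚ-nonNeg 1) (^ℚ-≥1 a)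

  ^ℚ-mono : ∀ {a b} → a ≤ b → L ^ℚ a ≤ℚ L ^ℚ b
  ^ℚ-mono {a} {b} a≤b with ℕₚ.m≤n⇒∃[o]m+o≡n a≤b
  ... | o , refl = begin
    L ^ℚ a                  ≡⟨ sym (ℚₚ.*-identityʳ (L ^ℚ a)) ⟩
    (L ^ℚ a) *ℚ 1ℚ          ≤⟨ ℚₚ.*-monoˡ-≤-nonNeg (L ^ℚ a) {{nonNegative (^ℚ-nonNeg a)}} (^ℚ-≥1 o) ⟩
    (L ^ℚ a) *ℚ (L ^ℚ o)    ≡⟨ ^ℚ-+ L a o ⟩
    L ^ℚ (a + o)            ∎
    where open ℚₚ.≤-Reasoning

  ^ℚ-*-bound : ∀ a b p q → toℚ a ≤ℚ L ^ℚ p → toℚ b ≤ℚ L ^ℚ q → toℚ (a * b) ≤ℚ L ^ℚ (p + q)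
  ^ℚ-*-bound a b p q a≤ b≤ = begin
    toℚ (a * b)             ≡⟨ toℚ-* a b ⟩
    toℚ a *ℚ toℚ b          ≤⟨ ℚₚ.*-monoʳ-≤-nonNeg (toℚ b) {{nonNegative (toℚ-nonNeg b)}} a≤ ⟩
    (L ^ℚ p) *ℚ toℚ b       ≤⟨ ℚₚ.*-monoˡ-≤-nonNeg (L ^ℚ p) {{nonNegative (^ℚ-nonNeg p)}} b≤ ⟩
    (L ^ℚ p) *ℚ (L ^ℚ q)    ≡⟨ ^ℚ-+ L p q ⟩
    L ^ℚ (p + q)            ∎
    where open ℚₚ.≤-Reasoning

seqs-length : ∀ n m s → s ∈ seqs n m → length s ≡ m
seqs-length n zero    .[] (here refl) = refl
seqs-length n (suc m) s s∈ with find (∈ₚ.∈-concatMap⁻ (λ x → map (x ∷_) (seqs n m)) {xs = allFin n} s∈)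
... | x , _ , s∈x with ∈ₚ.∈-map⁻ (x ∷_) {xs = seqs n m} s∈x
... | s′ , s′∈ , refl = cong suc (seqs-length n m s′ s′∈)

count-seqs-suc : ∀ n m (P : List (Fin n) → Bool) →
  count P (seqs n (suc m)) ≡ sum (map (λ x → count (λ s → P (x ∷ s)) (seqs n m)) (allFin n))
count-seqs-suc n m P = trans (count-concatMap P (λ x → map (x ∷_) (seqs n m)) (allFin n))
  (sum-cong _ _ (allFin n) (λ x → count-map P (x ∷_) (seqs n m)))

count-split : ∀ n a c (P R : List (Fin n) → Bool) →
  count (λ s → P (take a s) ∧ R (drop a s)) (seqs n (a + c)) ≡ count P (seqs n a) * count R (seqs n c)
count-split n zero c P R with P []
... | true  = sym (ℕₚ.+-identityʳ _)
... | false = count-none _ (seqs n c) (λ _ _ ())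
count-split n (suc a) c P R = begin
  count (λ s → P (take (suc a) s) ∧ R (drop (suc a) s)) (seqs n (suc a + c))
    ≡⟨ count-seqs-suc n (a + c) _ ⟩
  sum (map (λ x → count (λ s → P (x ∷ take a s) ∧ R (drop a s)) (seqs n (a + c))) (allFin n))
    ≡⟨ sum-cong _ _ (allFin n) (λ x → count-split n a c (λ s → P (x ∷ s)) R) ⟩
  sum (map (λ x → count (λ s → P (x ∷ s)) (seqs n a) * count R (seqs n c)) (allFin n))
    ≡⟨ sum-*ʳ (λ x → count (λ s → P (x ∷ s)) (seqs n a)) (count R (seqs n c)) (allFin n) ⟩
  sum (map (λ x → count (λ s → P (x ∷ s)) (seqs n a)) (allFin n)) * count R (seqs n c)
    ≡⟨ cong (_* count R (seqs n c)) (sym (count-seqs-suc n a P)) ⟩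
  count P (seqs n (suc a)) * count R (seqs n c) ∎
  where open ≡-Reasoning

sum-tabulate-single : ∀ {n} (v : Fin n) (f : Fin n → ℕ) → (∀ x → x ≢ v → f x ≡ 0) → sum (tabulate f) ≤ f v
sum-tabulate-single {suc n} Fin.zero f vanish =
  ℕₚ.≤-reflexive (trans (cong (f Fin.zero +_) (rest-zero (λ i → f (Fin.suc i)) (λ i → vanish (Fin.suc i) (λ ()))))
                        (ℕₚ.+-identityʳ _))
  where
  rest-zero : ∀ {m} (g : Fin m → ℕ) → (∀ i → g i ≡ 0) → sum (tabulate g) ≡ 0
  rest-zero {zero}  g g≡0 = refl
  rest-zero {suc m} g g≡0 rewrite g≡0 Fin.zero = rest-zero (λ i → g (Fin.suc i)) (λ i → g≡0 (Fin.suc i))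
sum-tabulate-single {suc n} (Fin.suc v) f vanish rewrite vanish Fin.zero (λ ()) =
  sum-tabulate-single v (λ i → f (Fin.suc i)) (λ x x≢v → vanish (Fin.suc x) (λ eq → x≢v (Finₚ.suc-injective eq)))

startsWith : ∀ {n} → Fin n → List (Fin n) → Bool
startsWith v []      = false
startsWith v (x ∷ _) = ⌊ x Fin.≟ v ⌋

startsWith-head : ∀ {n} (v : Fin n) w → T (startsWith v w) → ∃[ r ] (w ≡ v ∷ r)
startsWith-head v (x ∷ r) t with x Fin.≟ v
... | yes refl = r , refl

startsWith-∷ : ∀ {n} (v : Fin n) s → T (startsWith v (v ∷ s))
startsWith-∷ v s with v Fin.≟ v
... | yes _  = tt
... | no v≢v = v≢v refl

∈⇒place : ∀ {n} {v : Fin n} mid → v ∈ mid → ∃[ i ] (i < length mid × T (startsWith v (drop i mid)))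
∈⇒place (x ∷ mid) (here refl) = 0 , s≤s z≤n , startsWith-∷ x mid
∈⇒place (x ∷ mid) (there v∈) with ∈⇒place mid v∈
... | i , i< , t = suc i , s≤s i< , t

startsWith-other : ∀ {n} (v x : Fin n) s → x ≢ v → startsWith v (x ∷ s) ≡ false
startsWith-other v x s x≢v with x Fin.≟ v
... | yes x≡v = ⊥-elim (x≢v x≡v)
... | no  _   = refl

count-startsWith : ∀ n c (v : Fin n) (Q : List (Fin n) → Bool) →
  count (λ w → startsWith v w ∧ Q w) (seqs n (suc c)) ≤ count (λ s → Q (v ∷ s)) (seqs n c)
count-startsWith n c v Q = begin
  count (λ w → startsWith v w ∧ Q w) (seqs n (suc c))
    ≡⟨ count-seqs-suc n c _ ⟩
  sum (map byHead (allFin n))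
    ≡⟨ cong sum (Listₚ.map-tabulate (λ x → x) byHead) ⟩
  sum (tabulate byHead)
    ≤⟨ sum-tabulate-single v byHead (λ x x≢v → count-none _ (seqs n c)
         (λ s _ t → subst T (cong (_∧ Q (x ∷ s)) (startsWith-other v x s x≢v)) t)) ⟩
  byHead v
    ≤⟨ count-mono _ _ (seqs n c) (λ s _ t → ∧-snd {startsWith v (v ∷ s)} t) ⟩
  count (λ s → Q (v ∷ s)) (seqs n c) ∎
  where
  open ℕₚ.≤-Reasoning
  byHead : Fin n → ℕ
  byHead x = count (λ s → startsWith v (x ∷ s) ∧ Q (x ∷ s)) (seqs n c)

record ProperSubpath {X : Set} (p q : List X) : Set where
  constructor proper-subpath
  field
    start extra : ℕ
    fits        : start + suc extra ≤ plen p
    proper      : T (not ((start ≡ᵇ 0) ∧ (start + suc extra ≡ᵇ plen p)))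
    is-piece    : q ≡ subpath start (start + suc extra) p

module _ {X : Set} where

  piecesFrom : List X → ℕ → List (List X)
  piecesFrom p i = map (λ j → subpath i j p)
    (filterᵇ (λ j → not ((i ≡ᵇ 0) ∧ (j ≡ᵇ plen p))) (map (λ d → i + suc d) (upTo (plen p ∸ i))))

  opaque
    ∈properSubpaths⁻ : ∀ (p q : List X) → q ∈ properSubpaths p → ProperSubpath p q
    ∈properSubpaths⁻ p q q∈ with find (∈ₚ.∈-concatMap⁻ (piecesFrom p) {xs = upTo (suc (plen p))} q∈)
    ... | i , i∈ , q∈ᵢ with ∈ₚ.∈-map⁻ (λ j → subpath i j p) q∈ᵢ
    ... | j , j∈ , q≡ with ∈ₚ.∈-filter⁻ (λ j → T? (not ((i ≡ᵇ 0) ∧ (j ≡ᵇ plen p))))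
                             {xs = map (λ d → i + suc d) (upTo (plen p ∸ i))} j∈
    ... | j∈′ , proper with ∈ₚ.∈-map⁻ (λ d → i + suc d) {xs = upTo (plen p ∸ i)} j∈′
    ... | d , d∈ , refl = proper-subpath i d fits proper q≡
      where
      fits : i + suc d ≤ plen p
      fits = ℕₚ.≤-trans (ℕₚ.+-monoʳ-≤ i (∈ₚ.∈-upTo⁻ d∈))
                        (ℕₚ.≤-reflexive (ℕₚ.m+[n∸m]≡n (ℕₚ.≤-pred (∈ₚ.∈-upTo⁻ i∈))))

  ∈properSubpaths⁺ : ∀ (p : List X) i d → i + suc d ≤ plen p → T (not ((i ≡ᵇ 0) ∧ (i + suc d ≡ᵇ plen p))) →
    subpath i (i + suc d) p ∈ properSubpaths p
  ∈properSubpaths⁺ p i d fits proper = ∈ₚ.∈-concatMap⁺ (piecesFrom p) {xs = upTo (suc (plen p))}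
    (lose (∈ₚ.∈-upTo⁺ (s≤s (ℕₚ.≤-trans (ℕₚ.m≤m+n i (suc d)) fits)))
      (∈ₚ.∈-map⁺ (λ j → subpath i j p)
        (∈ₚ.∈-filter⁺ (λ j → T? (not ((i ≡ᵇ 0) ∧ (j ≡ᵇ plen p))))
                      {xs = map (λ d → i + suc d) (upTo (plen p ∸ i))}
          (∈ₚ.∈-map⁺ (λ d → i + suc d) (∈ₚ.∈-upTo⁺ d<)) proper)))
    where
    d< : d < plen p ∸ i
    d< = ℕₚ.m+n≤o⇒m≤o∸n (suc d) (subst (_≤ plen p) (ℕₚ.+-comm i (suc d)) fits)

  plen-subpath : ∀ (p : List X) i d → i + suc d ≤ plen p → plen (subpath i (i + suc d) p) ≡ suc d
  plen-subpath []      i d fits with () ← ℕₚ.≤-trans (ℕₚ.m≤n+m (suc d) i) fits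
  plen-subpath (x ∷ r) i d fits rewrite ℕₚ.m+n∸m≡n i (suc d)
    | Listₚ.length-take (suc (suc d)) (drop i (x ∷ r)) | Listₚ.length-drop i (x ∷ r) =
    cong (_∸ 1) (ℕₚ.m≤n⇒m⊓n≡m (ℕₚ.m+n≤o⇒m≤o∸n (suc (suc d)) fits′))
    where
    fits′ : suc (suc d) + i ≤ suc (length r)
    fits′ = subst (_≤ suc (length r)) (trans (sym (ℕₚ.+-suc i (suc d))) (ℕₚ.+-comm i (suc (suc d)))) (s≤s fits)

  properSubpath-plen : ∀ {p q : List X} (sp : ProperSubpath p q) → plen q ≡ suc (ProperSubpath.extra sp)
  properSubpath-plen {p} (proper-subpath i d fits _ refl) = plen-subpath p i d fits

  properSubpath-shorter : ∀ {p q : List X} (sp : ProperSubpath p q) → suc (ProperSubpath.extra sp) < plen p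
  properSubpath-shorter {p} (proper-subpath zero d fits proper _) =
    ℕₚ.≤∧≢⇒< fits (≢ᵇ⇒≢ (suc d) (plen p) proper)
  properSubpath-shorter {p} (proper-subpath (suc i) d fits _ _) =
    ℕₚ.≤-trans (s≤s (ℕₚ.m≤n+m (suc d) i)) fits

  properSubpath-bounds : ∀ (p q : List X) → q ∈ properSubpaths p → 1 ≤ plen q × plen q < plen p
  properSubpath-bounds p q q∈ =
    subst (1 ≤_) (sym (properSubpath-plen sp)) (s≤s z≤n) ,
    subst (_< plen p) (sym (properSubpath-plen sp)) (properSubpath-shorter sp)
    where sp = ∈properSubpaths⁻ p q q∈

module PathPieces {n : ℕ} (G : Graph n) where

  adjChain-drop : ∀ i (xs : List (Fin n)) → T (adjChain G xs) → T (adjChain G (drop i xs))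
  adjChain-drop zero    xs          t = t
  adjChain-drop (suc i) []          t = t
  adjChain-drop (suc i) (x ∷ [])    t = adjChain-drop i [] tt
  adjChain-drop (suc i) (x ∷ y ∷ r) t = adjChain-drop i (y ∷ r) (∧-snd {Adj G x y} t)

  adjChain-take : ∀ m (xs : List (Fin n)) → T (adjChain G xs) → T (adjChain G (take m xs))
  adjChain-take zero          xs          t = tt
  adjChain-take (suc m)       []          t = tt
  adjChain-take (suc zero)    (x ∷ r)     t = tt
  adjChain-take (suc (suc m)) (x ∷ [])    t = tt
  adjChain-take (suc (suc m)) (x ∷ y ∷ r) t =
    ∧-pair {Adj G x y} (∧-fst t) (adjChain-take (suc m) (y ∷ r) (∧-snd {Adj G x y} t))

  allB-take : ∀ (P : Fin n → Bool) m xs → T (allB P xs) → T (allB P (take m xs))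
  allB-take P zero    xs       t = tt
  allB-take P (suc m) []       t = tt
  allB-take P (suc m) (x ∷ xs) t = ∧-pair {P x} (∧-fst t) (allB-take P m xs (∧-snd {P x} t))

  distinct-drop : ∀ i (xs : List (Fin n)) → T (distinct G xs) → T (distinct G (drop i xs))
  distinct-drop zero    xs      t = t
  distinct-drop (suc i) []      t = t
  distinct-drop (suc i) (x ∷ r) t = distinct-drop i r (∧-snd {notIn G x r} t)

  distinct-take : ∀ m (xs : List (Fin n)) → T (distinct G xs) → T (distinct G (take m xs))
  distinct-take zero    xs      t = tt
  distinct-take (suc m) []      t = tt
  distinct-take (suc m) (x ∷ r) t =
    ∧-pair {notIn G x (take m r)} (allB-take _ m r (∧-fst t)) (distinct-take m r (∧-snd {notIn G x r} t))

  nonempty-take : ∀ m (xs : List (Fin n)) → 0 < length xs → T (nonempty G (take (suc m) xs))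
  nonempty-take m (x ∷ xs) _ = tt

  nonempty-subpath : ∀ (p : List (Fin n)) i d → i + suc d ≤ plen p → T (nonempty G (subpath i (i + suc d) p))
  nonempty-subpath []      i d fits with () ← ℕₚ.≤-trans (ℕₚ.m≤n+m (suc d) i) fits
  nonempty-subpath (x ∷ r) i d fits = nonempty-take _ (drop i (x ∷ r))
    (subst (0 <_) (sym (Listₚ.length-drop i (x ∷ r))) (ℕₚ.m<n⇒0<n∸m (s≤s (ℕₚ.≤-trans (ℕₚ.m≤m+n i (suc d)) fits))))

  isPath-properSubpath : ∀ (p q : List (Fin n)) → T (isPathB G p) → q ∈ properSubpaths p → T (isPathB G q)
  isPath-properSubpath p q path q∈ with ∈properSubpaths⁻ p q q∈
  ... | proper-subpath i d fits _ refl =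
    ∧-pair {nonempty G piece} (nonempty-subpath p i d fits)
      (∧-pair {adjChain G piece}
        (adjChain-take (suc (i + suc d ∸ i)) (drop i p) (adjChain-drop i p (∧-fst (∧-snd {nonempty G p} path))))
        (distinct-take (suc (i + suc d ∸ i)) (drop i p) (distinct-drop i p (∧-snd {adjChain G p} (∧-snd {nonempty G p} path)))))
    where piece = subpath i (i + suc d) p

module Windows {X : Set} (u : ℕ → X) where

  window : ℕ → ℕ → List X
  window a zero    = u a ∷ []
  window a (suc d) = u a ∷ window (suc a) d

  applyUpTo≡window : ∀ (h : ℕ → X) a d → (∀ j → h j ≡ u (a + j)) → applyUpTo h (suc d) ≡ window a d
  applyUpTo≡window h a zero    h≡ = cong (_∷ []) (trans (h≡ 0) (cong u (ℕₚ.+-identityʳ a)))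
  applyUpTo≡window h a (suc d) h≡ = cong₂ _∷_ (trans (h≡ 0) (cong u (ℕₚ.+-identityʳ a)))
    (applyUpTo≡window (λ j → h (suc j)) (suc a) d (λ j → trans (h≡ (suc j)) (cong u (ℕₚ.+-suc a j))))

  map-upTo≡window : ∀ a d → map (λ j → u (a + j)) (upTo (suc d)) ≡ window a d
  map-upTo≡window a d =
    trans (Listₚ.map-applyUpTo (λ x → x) (λ j → u (a + j)) (suc d)) (applyUpTo≡window _ a d (λ j → refl))

  length-window : ∀ a d → length (window a d) ≡ suc d
  length-window a zero    = refl
  length-window a (suc d) = cong suc (length-window (suc a) d)

  plen-window : ∀ a d → plen (window a d) ≡ d
  plen-window a d = cong (_∸ 1) (length-window a d)

  drop-window : ∀ a d i → i ≤ d → drop i (window a d) ≡ window (a + i) (d ∸ i)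
  drop-window a d       zero    _         rewrite ℕₚ.+-identityʳ a = refl
  drop-window a (suc d) (suc i) (s≤s i≤d) rewrite ℕₚ.+-suc a i = drop-window (suc a) d i i≤d

  take-window : ∀ a d e → e ≤ d → take (suc e) (window a d) ≡ window a e
  take-window a zero    zero    _         = refl
  take-window a (suc d) zero    _         = refl
  take-window a (suc d) (suc e) (s≤s e≤d) = cong (u a ∷_) (take-window (suc a) d e e≤d)

  subpath-window : ∀ a d i e → i + suc e ≤ d → subpath i (i + suc e) (window a d) ≡ window (a + i) (suc e)
  subpath-window a d i e fits rewrite ℕₚ.m+n∸m≡n i (suc e)
    | drop-window a d i (ℕₚ.≤-trans (ℕₚ.m≤m+n i (suc e)) fits) =
    take-window (a + i) (d ∸ i) (suc e) (ℕₚ.m+n≤o⇒m≤o∸n (suc e) (subst (_≤ d) (ℕₚ.+-comm i (suc e)) fits))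

  lastOr-window : ∀ z a d → lastOr z (window a d) ≡ u (a + d)
  lastOr-window z a zero    = cong u (sym (ℕₚ.+-identityʳ a))
  lastOr-window z a (suc d) = trans (lastOr-window (u a) (suc a) d) (cong u (sym (ℕₚ.+-suc a d)))

sameEnds-∈ : ∀ {n} x (rest : List (Fin n)) r → r ∈ sameEnds (x ∷ rest) →
  ∃[ mid ] (mid ∈ seqs n (length rest ∸ 1) × r ≡ x ∷ mid ++ [ lastOr x rest ])
sameEnds-∈ {n} x rest r r∈ = ∈ₚ.∈-map⁻ (λ mid → x ∷ mid ++ [ lastOr x rest ]) {xs = seqs n (length rest ∸ 1)} r∈

sameEnds-plen : ∀ {n} (p : List (Fin n)) r → 1 ≤ plen p → r ∈ sameEnds p → plen r ≡ plen p
sameEnds-plen {n} (x ∷ rest) r 1≤ r∈ with sameEnds-∈ x rest r r∈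
... | mid , mid∈ , refl = begin
  length (mid ++ [ lastOr x rest ])  ≡⟨ Listₚ.length-++ mid ⟩
  length mid + 1                     ≡⟨ cong (_+ 1) (seqs-length n _ mid mid∈) ⟩
  length rest ∸ 1 + 1                ≡⟨ ℕₚ.m∸n+n≡m 1≤ ⟩
  length rest                        ∎
  where open ≡-Reasoning

lastOr-snoc : ∀ {A : Set} (z : A) l v → lastOr z (l ++ [ v ]) ≡ v
lastOr-snoc z []      v = refl
lastOr-snoc z (x ∷ l) v = lastOr-snoc x l v

length-snoc : ∀ {A : Set} (l : List A) v → length (l ++ [ v ]) ≡ suc (length l)
length-snoc l v = trans (Listₚ.length-++ l) (ℕₚ.+-comm (length l) 1)

count-sameEnds : ∀ {n} (P : List (Fin n) → Bool) x (mid : List (Fin n)) z →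
  count P (sameEnds (x ∷ mid ++ [ z ])) ≡ count (λ m → P (x ∷ m ++ [ z ])) (seqs n (length mid))
count-sameEnds {n} P x mid z = trans (count-map P _ (seqs n (length (mid ++ [ z ]) ∸ 1)))
  (cong₂ (λ z′ k → count (λ m → P (x ∷ m ++ [ z′ ])) (seqs n k))
    (lastOr-snoc x mid z) (cong (_∸ 1) (length-snoc mid z)))

module Goodness {n : ℕ} (G : Graph n) (L : ℚ) where

  adm good : ℕ → List (Fin n) → Bool
  adm  = admF G L
  good = goodF G L

  if-false : ∀ {b} {x y : Bool} → b ≡ false → (if b then x else y) ≡ y
  if-false refl = refl

  ≡ᵇ1-false : ∀ m → 2 ≤ m → (m ≡ᵇ 1) ≡ false
  ≡ᵇ1-false (suc (suc m)) _ = refl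
  ≡ᵇ1-false (suc zero) (s≤s ())

  good-unfold : ∀ f (p : List (Fin n)) → 2 ≤ plen p →
    good (suc f) p ≡ (adm f p ∧ (toℚ (count (adm f) (sameEnds p)) ℚ.≤ᵇ fbound (plen p) L))
  good-unfold f p 2≤ = if-false (≡ᵇ1-false (plen p) 2≤)

  good⇒adm : ∀ f (p : List (Fin n)) → 2 ≤ plen p → T (good (suc f) p) → T (adm f p)
  good⇒adm f p 2≤ t = ∧-fst (subst T (good-unfold f p 2≤) t)

  adm⇒path : ∀ f (p : List (Fin n)) → T (adm f p) → T (isPathB G p)
  adm⇒path f p = ∧-fst

  adm⇒subpath-good : ∀ f (p q : List (Fin n)) → T (adm f p) → q ∈ properSubpaths p → T (good f q)
  adm⇒subpath-good f p q t q∈ = allB-elem (good f) (properSubpaths p) (∧-snd {isPathB G p} t) q∈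

  good⇒subpath-good : ∀ f (p q : List (Fin n)) → 2 ≤ plen p → T (good (suc f) p) → q ∈ properSubpaths p → T (good f q)
  good⇒subpath-good f p q 2≤ t = adm⇒subpath-good f p q (good⇒adm f p 2≤ t)

  mutual
    adm-fuel : ∀ f f′ (p : List (Fin n)) → plen p ≤ suc f → plen p ≤ suc f′ → adm f p ≡ adm f′ p
    adm-fuel f f′ p ≤f ≤f′ = cong (isPathB G p ∧_) (allB-ext (good f) (good f′) (properSubpaths p) (λ q q∈ →
      good-fuel f f′ q (proj₁ (properSubpath-bounds p q q∈))
        (ℕₚ.≤-pred (ℕₚ.≤-trans (proj₂ (properSubpath-bounds p q q∈)) ≤f))
        (ℕₚ.≤-pred (ℕₚ.≤-trans (proj₂ (properSubpath-bounds p q q∈)) ≤f′))))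

    good-fuel : ∀ f f′ (p : List (Fin n)) → 1 ≤ plen p → plen p ≤ f → plen p ≤ f′ → good f p ≡ good f′ p
    good-fuel zero     f′       p 1≤ ≤f ≤f′ = ⊥-elim (ℕₚ.n≮0 (ℕₚ.≤-trans 1≤ ≤f))
    good-fuel (suc f)  zero     p 1≤ ≤f ≤f′ = ⊥-elim (ℕₚ.n≮0 (ℕₚ.≤-trans 1≤ ≤f′))
    good-fuel (suc f)  (suc f′) p 1≤ ≤f ≤f′ =
      cong (if plen p ≡ᵇ 1 then isPathB G p else_)
        (cong₂ _∧_ (adm-fuel f f′ p ≤f ≤f′)
          (cong (λ c → toℚ c ℚ.≤ᵇ fbound (plen p) L)
            (count-ext (adm f) (adm f′) (sameEnds p) (λ r r∈ →
              adm-fuel f f′ r (subst (_≤ suc f) (sym (sameEnds-plen p r 1≤ r∈)) ≤f)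
                              (subst (_≤ suc f′) (sym (sameEnds-plen p r 1≤ r∈)) ≤f′)))))

  -- The defining bound of goodness, extended to length 1 (where it holds as
  -- sameEnds has one element) and stated for good paths, which are admissible.
  good⇒few-good : (1≤L : 1ℚ ≤ℚ L) → ∀ f (q : List (Fin n)) → T (good f q) → 1 ≤ plen q →
    toℚ (count (good f) (sameEnds q)) ≤ℚ fbound (plen q) L
  good⇒few-good 1≤L zero    q () 1≤
  good⇒few-good 1≤L (suc f) q@(x ∷ rest) t 1≤ = by-length (ℕₚ.m≤n⇒m<n∨m≡n 1≤)
    where
    by-length : 1 < plen q ⊎ 1 ≡ plen q → toℚ (count (good (suc f)) (sameEnds q)) ≤ℚ fbound (plen q) L
    by-length (inj₂ 1≡) = ℚₚ.≤-trans (toℚ-mono one) (Powers.^ℚ-≥1 L 1≤L (5 ^ plen q))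
      where
      one : count (good (suc f)) (sameEnds q) ≤ 1
      one = ℕₚ.≤-trans (count≤length (good (suc f)) (sameEnds q)) (ℕₚ.≤-reflexive
        (trans (Listₚ.length-map _ (seqs n (length rest ∸ 1))) (cong (λ ℓ → length (seqs n (ℓ ∸ 1))) (sym 1≡))))
    by-length (inj₁ 2≤) = ℚₚ.≤-trans
      (toℚ-mono (count-mono (good (suc f)) (adm f) (sameEnds q)
        (λ r r∈ → good⇒adm f r (subst (2 ≤_) (sym (sameEnds-plen q r 1≤ r∈)) 2≤))))
      (ℚₚ.≤ᵇ⇒≤ (∧-snd {adm f q} (subst T (good-unfold f q 2≤) t)))

  good⇒piece-good : ∀ F (p q : List (Fin n)) → plen p ≤ F → T (good F p) → q ∈ properSubpaths p →
    T (good (plen q) q)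
  good⇒piece-good zero    p q ≤F t q∈ = ⊥-elim (ℕₚ.n≮0 (ℕₚ.<-≤-trans (proj₂ (properSubpath-bounds p q q∈)) ≤F))
  good⇒piece-good (suc F) p q ≤F t q∈ =
    subst T (good-fuel F (plen q) q 1≤ (ℕₚ.≤-pred (ℕₚ.≤-trans shorter ≤F)) ℕₚ.≤-refl)
      (good⇒subpath-good F p q (ℕₚ.≤-trans (s≤s 1≤) shorter) t q∈)
    where
    1≤      = proj₁ (properSubpath-bounds p q q∈)
    shorter = proj₂ (properSubpath-bounds p q q∈)

  not-good-cases : ∀ f (p : List (Fin n)) → 2 ≤ plen p → T (isPathB G p) → ¬ T (good (suc f) p) →
    fbound (plen p) L <ℚ toℚ (count (adm f) (sameEnds p)) ⊎ ∃[ q ] (q ∈ properSubpaths p × ¬ T (good f q))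
  not-good-cases f p 2≤ path not-good = by-admissibility (adm f p) refl
    where
    by-admissibility : ∀ b → adm f p ≡ b →
      fbound (plen p) L <ℚ toℚ (count (adm f) (sameEnds p)) ⊎ ∃[ q ] (q ∈ properSubpaths p × ¬ T (good f q))
    by-admissibility true  eq = inj₁ (ℚₚ.≰⇒> λ few → not-good
      (subst T (sym (good-unfold f p 2≤)) (∧-pair {adm f p} (subst T (sym eq) tt) (ℚₚ.≤⇒≤ᵇ few))))
    by-admissibility false eq = inj₂ (allB-counterexample (good f) (properSubpaths p)
      (λ all-good → subst T eq (∧-pair {isPathB G p} path all-good)))

module MinimalBadWindow {n : ℕ} (G : Graph n) (L : ℚ) (k : ℕ) (1≤k : 1 ≤ k) (u : ℕ → Fin n)
    (k-windows-good : ∀ i → i ≤ k → T (Goodness.good G L k (Windows.window u i k))) where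
  open Goodness G L
  open Windows u
  open PathPieces G

  short-subwindow-good : ∀ i o e → i ≤ k → o + suc e ≤ k → suc e < k → T (good (suc e) (window (i + o) (suc e)))
  short-subwindow-good i o e i≤k fits short =
    subst₂ (λ ℓ w → T (good ℓ w)) (plen-subpath (window i k) o e fits′) (subpath-window i k o e fits)
      (good⇒piece-good k (window i k) _ (ℕₚ.≤-reflexive (plen-window i k)) (k-windows-good i i≤k)
        (∈properSubpaths⁺ (window i k) o e fits′ proper))
    where
    fits′ : o + suc e ≤ plen (window i k)
    fits′ = subst (o + suc e ≤_) (sym (plen-window i k)) fits
    not-whole : ∀ o′ → T (not ((o′ ≡ᵇ 0) ∧ (o′ + suc e ≡ᵇ k)))
    not-whole zero    = ≢⇒≢ᵇ (suc e) k (ℕₚ.<⇒≢ short)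
    not-whole (suc _) = tt
    proper : T (not ((o ≡ᵇ 0) ∧ (o + suc e ≡ᵇ plen (window i k))))
    proper = subst (λ ℓ → T (not ((o ≡ᵇ 0) ∧ (o + suc e ≡ᵇ ℓ)))) (sym (plen-window i k)) (not-whole o)

  -- Every window of length between 1 and k inside u 0 … u (2k) is good: it lies in
  -- the k-window starting at a, or in the last k-window if a > k.
  short-window-good : ∀ a d → 1 ≤ d → d ≤ k → a + d ≤ k + k → T (good d (window a d))
  short-window-good a (suc e) _ d≤k fits = by-length (ℕₚ.m≤n⇒m<n∨m≡n d≤k)
    where
    at : ∀ {b b′} → b ≡ b′ → T (good (suc e) (window b (suc e))) → T (good (suc e) (window b′ (suc e)))
    at eq = subst (λ b → T (good (suc e) (window b (suc e)))) eq
    by-start : suc e < k → Dec (a ≤ k) → T (good (suc e) (window a (suc e)))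
    by-start d<k (yes a≤k) = at (ℕₚ.+-identityʳ a) (short-subwindow-good a 0 e a≤k (ℕₚ.<⇒≤ d<k) d<k)
    by-start d<k (no  a≰k) = at (ℕₚ.m+[n∸m]≡n k≤a) (short-subwindow-good k (a ∸ k) e ℕₚ.≤-refl fits′ d<k)
      where
      k≤a = ℕₚ.<⇒≤ (ℕₚ.≰⇒> a≰k)
      fits′ : a ∸ k + suc e ≤ k
      fits′ = subst (_≤ k) (ℕₚ.+-∸-comm (suc e) k≤a)
                (ℕₚ.≤-trans (ℕₚ.∸-monoˡ-≤ k fits) (ℕₚ.≤-reflexive (ℕₚ.m+n∸n≡m k k)))
    by-length : suc e < k ⊎ suc e ≡ k → T (good (suc e) (window a (suc e)))
    by-length (inj₁ d<k) = by-start d<k (a ≤? k)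
    by-length (inj₂ d≡k) = subst (λ ℓ → T (good ℓ (window a ℓ))) (sym d≡k)
      (k-windows-good a (ℕₚ.+-cancelʳ-≤ k a k (subst (λ ℓ → a + ℓ ≤ k + k) d≡k fits)))

  record BadWindow : Set where
    field
      start len′ : ℕ
      long       : k < suc len′
      inside     : start + suc len′ ≤ k + k
      crowded    : fbound (suc len′) L <ℚ toℚ (count (adm len′) (sameEnds (window start (suc len′))))

  -- A window of u 0 … u (2k) which is a path but not good contains a bad window:
  -- descend to a non-good proper subwindow as long as the window is not admissible.
  find-bad-window : ∀ t a d → d ≤ t → 1 ≤ d → a + d ≤ k + k →
    T (isPathB G (window a d)) → ¬ T (good d (window a d)) → BadWindow
  find-bad-window zero    a d       d≤t 1≤d _ _ _ = ⊥-elim (ℕₚ.n≮0 (ℕₚ.≤-trans 1≤d d≤t))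
  find-bad-window (suc t) a zero    _   ()
  find-bad-window (suc t) a (suc e) d≤t _ fits path not-good = by-length (k <? suc e)
    where
    W = window a (suc e)
    plen-W : plen W ≡ suc e
    plen-W = plen-window a (suc e)
    by-cases : fbound (plen W) L <ℚ toℚ (count (adm e) (sameEnds W))
               ⊎ ∃[ q ] (q ∈ properSubpaths W × ¬ T (good e q)) → k < suc e → BadWindow
    by-cases (inj₁ crowded) k<d =
      record { start = a ; len′ = e ; long = k<d ; inside = fits
             ; crowded = subst (λ ℓ → fbound ℓ L <ℚ toℚ (count (adm e) (sameEnds W))) plen-W crowded }
    by-cases (inj₂ (q , q∈ , q-not-good)) _ with ∈properSubpaths⁻ W q q∈
    ... | sp@(proper-subpath i e′ fits-q _ refl) =
      find-bad-window t (a + i) (suc e′) (ℕₚ.≤-trans (ℕₚ.≤-pred shorter) (ℕₚ.≤-pred d≤t)) (s≤s z≤n) fits′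
        (subst (λ w → T (isPathB G w)) q≡ (isPath-properSubpath W q path q∈))
        (λ good-q → q-not-good (subst T (good-fuel (suc e′) e q (subst (1 ≤_) (sym plen-q) (s≤s z≤n))
                                                    (ℕₚ.≤-reflexive plen-q) (subst (_≤ e) (sym plen-q) (ℕₚ.≤-pred shorter)))
                                  (subst (λ w → T (good (suc e′) w)) (sym q≡) good-q)))
      where
      plen-q : plen q ≡ suc e′
      plen-q = properSubpath-plen sp
      fits-W : i + suc e′ ≤ suc e
      fits-W = subst (i + suc e′ ≤_) plen-W fits-q
      q≡ : q ≡ window (a + i) (suc e′)
      q≡ = subpath-window a (suc e) i e′ fits-W
      shorter : suc e′ < suc e
      shorter = subst (suc e′ <_) plen-W (properSubpath-shorter sp)
      fits′ : a + i + suc e′ ≤ k + k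
      fits′ = ℕₚ.≤-trans (ℕₚ.≤-reflexive (ℕₚ.+-assoc a i (suc e′)))
                         (ℕₚ.≤-trans (ℕₚ.+-monoʳ-≤ a fits-W) fits)
    by-length : Dec (k < suc e) → BadWindow
    by-length (no  k≮d) = ⊥-elim (not-good (short-window-good a (suc e) (s≤s z≤n) (ℕₚ.≮⇒≥ k≮d) fits))
    by-length (yes k<d) = by-cases (not-good-cases e W 2≤ path not-good) k<d
      where
      2≤ : 2 ≤ plen W
      2≤ = subst (2 ≤_) (sym plen-W) (ℕₚ.≤-trans (s≤s 1≤k) k<d)

module _ {A : Set} where

  drop≡∷-length : ∀ i (xs : List A) {v r} → drop i xs ≡ v ∷ r → length xs ≡ i + suc (length r)
  drop≡∷-length zero    (x ∷ xs) refl = refl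
  drop≡∷-length (suc i) (x ∷ xs) eq   = cong suc (drop≡∷-length i xs eq)

  take-suc-++ : ∀ i (xs ys : List A) {v r} → drop i xs ≡ v ∷ r → take (suc i) (xs ++ ys) ≡ take i xs ++ [ v ]
  take-suc-++ zero    (x ∷ xs) ys refl = refl
  take-suc-++ (suc i) (x ∷ xs) ys eq   = cong (x ∷_) (take-suc-++ i xs ys eq)

  drop-++ : ∀ i (xs ys : List A) {v r} → drop i xs ≡ v ∷ r → drop i (xs ++ ys) ≡ v ∷ r ++ ys
  drop-++ zero    (x ∷ xs) ys refl = refl
  drop-++ (suc i) (x ∷ xs) ys eq   = drop-++ i xs ys eq

  length-take-≤ : ∀ i (xs : List A) → i ≤ length xs → length (take i xs) ≡ i
  length-take-≤ i xs i≤ = trans (Listₚ.length-take i xs) (ℕₚ.m≤n⇒m⊓n≡m i≤)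

module Cut {n : ℕ} (G : Graph n) (L : ℚ) (f : ℕ) (x y : Fin n)
    (mid : List (Fin n)) (i : ℕ) (v : Fin n) (r : List (Fin n)) (at-i : drop i mid ≡ v ∷ r)
    (admissible : T (Goodness.adm G L f (x ∷ mid ++ [ y ]))) where
  open Goodness G L

  path = x ∷ mid ++ [ y ]
  c    = length r

  plen-path : plen path ≡ suc (i + suc c)
  plen-path = trans (length-snoc mid y) (cong suc (drop≡∷-length i mid at-i))

  prefix-good : T (good f (x ∷ take i mid ++ [ v ]))
  prefix-good = subst (λ w → T (good f w)) (cong (x ∷_) (take-suc-++ i mid [ y ] at-i))
    (adm⇒subpath-good f path _ admissible (∈properSubpaths⁺ path 0 i fits proper))
    where
    fits : suc i ≤ plen path
    fits = subst (suc i ≤_) (sym plen-path) (s≤s (ℕₚ.m≤m+n i (suc c)))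
    proper : T (not (suc i ≡ᵇ plen path))
    proper = ≢⇒≢ᵇ (suc i) (plen path) (λ eq → ℕₚ.m+1+n≢m i (sym (ℕₚ.suc-injective (trans eq plen-path))))

  suffix-good : T (good f (v ∷ r ++ [ y ]))
  suffix-good = subst (λ w → T (good f w)) piece≡
    (adm⇒subpath-good f path _ admissible (∈properSubpaths⁺ path (suc i) c (ℕₚ.≤-reflexive (sym plen-path)) tt))
    where
    piece≡ : subpath (suc i) (suc i + suc c) path ≡ v ∷ r ++ [ y ]
    piece≡ = begin
      take (suc (suc i + suc c ∸ suc i)) (drop i (mid ++ [ y ]))  ≡⟨ cong₂ (λ ℓ w → take (suc ℓ) w)
                                                                      (ℕₚ.m+n∸m≡n (suc i) (suc c)) (drop-++ i mid [ y ] at-i) ⟩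
      take (suc (suc c)) (v ∷ r ++ [ y ])                        ≡⟨ Listₚ.take-all (suc (suc c)) (v ∷ r ++ [ y ])
                                                                      (ℕₚ.≤-reflexive (cong suc (length-snoc r y))) ⟩
      v ∷ r ++ [ y ]                                             ∎
      where open ≡-Reasoning

5^-split : ∀ a b → 5 ^ suc a + 5 ^ suc b ≤ 5 ^ (suc a + suc b) ∸ 1
5^-split a b = ℕₚ.m+n≤o⇒m≤o∸n (5 ^ suc a + 5 ^ suc b) (begin
  5 * x + 5 * y + 1                   ≤⟨ ℕₚ.+-mono-≤ (ℕₚ.+-mono-≤ (ℕₚ.*-monoʳ-≤ 5 x≤xy) (ℕₚ.*-monoʳ-≤ 5 y≤xy)) 1≤xy ⟩
  5 * (x * y) + 5 * (x * y) + x * y   ≡⟨ solve 1 (λ z → con 5 :* z :+ con 5 :* z :+ z := con 11 :* z) refl (x * y) ⟩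
  11 * (x * y)                        ≤⟨ ℕₚ.*-monoˡ-≤ (x * y) (ℕₚ.m≤m+n 11 14) ⟩
  25 * (x * y)                        ≡⟨ solve 2 (λ x y → con 25 :* (x :* y) := (con 5 :* x) :* (con 5 :* y)) refl x y ⟩
  5 ^ suc a * 5 ^ suc b               ≡⟨ sym (ℕₚ.^-distribˡ-+-* 5 (suc a) (suc b)) ⟩
  5 ^ (suc a + suc b)                 ∎)
  where
  open ℕₚ.≤-Reasoning
  open +-*-Solver
  x = 5 ^ a
  y = 5 ^ b
  1≤x : 1 ≤ x
  1≤x = ℕₚ.^-monoʳ-≤ 5 {0} {a} z≤n
  1≤y : 1 ≤ y
  1≤y = ℕₚ.^-monoʳ-≤ 5 {0} {b} z≤n
  x≤xy : x ≤ x * y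
  x≤xy = ℕₚ.m≤m*n x y {{ℕ.>-nonZero 1≤y}}
  y≤xy : y ≤ x * y
  y≤xy = ℕₚ.m≤n*m y x {{ℕ.>-nonZero 1≤x}}
  1≤xy : 1 ≤ x * y
  1≤xy = ℕₚ.≤-trans 1≤x x≤xy

module SplittingBound {n : ℕ} (G : Graph n) (L : ℚ) (1≤L : 1ℚ ≤ℚ L) (f : ℕ) (x y : Fin n) where
  open Goodness G L
  open Powers L 1≤L

  admissible-interior : List (Fin n) → Bool
  admissible-interior mid = adm f (x ∷ mid ++ [ y ])

  has-at : Fin n → ℕ → List (Fin n) → Bool
  has-at v i mid = startsWith v (drop i mid)

  passing : Fin n → ℕ → List (Fin n) → Bool
  passing v i mid = admissible-interior mid ∧ has-at v i mid

  module _ (v : Fin n) (i c : ℕ) where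

    good-prefixes good-suffixes : ℕ
    good-prefixes = count (λ p → good f (x ∷ p ++ [ v ])) (seqs n i)
    good-suffixes = count (λ s → good f (v ∷ s ++ [ y ])) (seqs n c)

    -- An admissible interior through v at i is a good prefix followed by a good suffix.
    count-passing≤ : count (passing v i) (seqs n (i + suc c)) ≤ good-prefixes * good-suffixes
    count-passing≤ = begin
      count (passing v i) (seqs n (i + suc c))
        ≤⟨ count-mono _ _ (seqs n (i + suc c)) cut ⟩
      count (λ s → Prefix (take i s) ∧ Suffix (drop i s)) (seqs n (i + suc c))
        ≡⟨ count-split n i (suc c) Prefix Suffix ⟩
      good-prefixes * count Suffix (seqs n (suc c))
        ≤⟨ ℕₚ.*-monoʳ-≤ good-prefixes (count-startsWith n c v (λ w → good f (w ++ [ y ]))) ⟩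
      good-prefixes * good-suffixes ∎
      where
      open ℕₚ.≤-Reasoning
      Prefix Suffix : List (Fin n) → Bool
      Prefix p = good f (x ∷ p ++ [ v ])
      Suffix w = startsWith v w ∧ good f (w ++ [ y ])
      cut : ∀ mid → mid ∈ seqs n (i + suc c) → T (passing v i mid) → T (Prefix (take i mid) ∧ Suffix (drop i mid))
      cut mid _ t with startsWith-head v (drop i mid) (∧-snd {admissible-interior mid} t)
      ... | r , at-i = ∧-pair {Prefix (take i mid)} (Cut.prefix-good G L f x y mid i v r at-i (∧-fst t))
        (∧-pair {startsWith v (drop i mid)} (∧-snd {admissible-interior mid} t)
          (subst (λ w → T (good f (w ++ [ y ]))) (sym at-i) (Cut.suffix-good G L f x y mid i v r at-i (∧-fst t))))

    -- If some admissible interior passes through v at i, both factors are bounded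
    -- by goodness of its two pieces; so in any case the count is ≤ L^(5^(i+c+2) - 1).
    count-passing-bound : toℚ (count (passing v i) (seqs n (i + suc c))) ≤ℚ L ^ℚ (5 ^ (suc i + suc c) ∸ 1)
    count-passing-bound with count (passing v i) (seqs n (i + suc c)) in eq
    ... | zero  = ^ℚ-nonNeg (5 ^ (suc i + suc c) ∸ 1)
    ... | suc N with count-witness (passing v i) (seqs n (i + suc c)) (subst (0 <_) (sym eq) (s≤s z≤n))
    ... | mid , mid∈ , t with startsWith-head v (drop i mid) (∧-snd {admissible-interior mid} t)
    ... | r , at-i = ℚₚ.≤-trans (toℚ-mono (subst (_≤ good-prefixes * good-suffixes) eq count-passing≤))
                       (ℚₚ.≤-trans (^ℚ-*-bound good-prefixes good-suffixes (5 ^ suc i) (5 ^ suc c) prefixes-bound suffixes-bound)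
                         (^ℚ-mono (5^-split i c)))
      where
      length-r : length r ≡ c
      length-r = ℕₚ.suc-injective (ℕₚ.+-cancelˡ-≡ i _ _
        (trans (sym (drop≡∷-length i mid at-i)) (seqs-length n _ mid mid∈)))
      length-prefix : length (take i mid) ≡ i
      length-prefix = length-take-≤ i mid
        (ℕₚ.≤-trans (ℕₚ.m≤m+n i (suc c)) (ℕₚ.≤-reflexive (sym (seqs-length n _ mid mid∈))))
      prefixes-bound : toℚ good-prefixes ≤ℚ fbound (suc i) L
      prefixes-bound = subst₂ (λ m ℓ → toℚ m ≤ℚ fbound ℓ L)
        (trans (count-sameEnds (good f) x (take i mid) v) (cong (λ ℓ → count _ (seqs n ℓ)) length-prefix))
        (trans (length-snoc (take i mid) v) (cong suc length-prefix))
        (good⇒few-good 1≤L f (x ∷ take i mid ++ [ v ]) (Cut.prefix-good G L f x y mid i v r at-i (∧-fst t))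
          (subst (1 ≤_) (sym (length-snoc (take i mid) v)) (s≤s z≤n)))
      suffixes-bound : toℚ good-suffixes ≤ℚ fbound (suc c) L
      suffixes-bound = subst₂ (λ m ℓ → toℚ m ≤ℚ fbound ℓ L)
        (trans (count-sameEnds (good f) v r y) (cong (λ ℓ → count _ (seqs n ℓ)) length-r))
        (trans (length-snoc r y) (cong suc length-r))
        (good⇒few-good 1≤L f (v ∷ r ++ [ y ]) (Cut.suffix-good G L f x y mid i v r at-i (∧-fst t))
          (subst (1 ≤_) (sym (length-snoc r y)) (s≤s z≤n)))

  count-passing-bound′ : ∀ v i D → i < D → toℚ (count (passing v i) (seqs n D)) ≤ℚ L ^ℚ (5 ^ suc D ∸ 1)
  count-passing-bound′ v i D i<D =
    subst (λ ℓ → toℚ (count (passing v i) (seqs n ℓ)) ≤ℚ L ^ℚ (5 ^ suc ℓ ∸ 1))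
      (trans (ℕₚ.+-suc i c) (proj₂ split)) (count-passing-bound v i c)
    where
    split = ℕₚ.m≤n⇒∃[o]m+o≡n i<D
    c = proj₁ split

  length-cartesianProduct : ∀ {A B : Set} (xs : List A) (ys : List B) →
    length (cartesianProduct xs ys) ≡ length xs * length ys
  length-cartesianProduct []       ys = refl
  length-cartesianProduct (x ∷ xs) ys = trans (Listₚ.length-++ (map (x ,_) ys))
    (cong₂ _+_ (Listₚ.length-map (x ,_) ys) (length-cartesianProduct xs ys))

  count-hitting : ∀ D (S : List (Fin n)) →
    (∀ mid → mid ∈ seqs n D → T (admissible-interior mid) → Any (_∈ S) mid) →
    toℚ (count admissible-interior (seqs n D)) ≤ℚ toℚ (length S * D) *ℚ L ^ℚ (5 ^ suc D ∸ 1)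
  count-hitting D S hits = begin
    toℚ (count admissible-interior (seqs n D))
      ≤⟨ toℚ-mono (union-bound admissible-interior at-place places (seqs n D) located) ⟩
    toℚ (sum (map passing-count places))
      ≤⟨ sum-boundℚ passing-count _ places (λ (v , i) vi∈ →
           count-passing-bound′ v i D (∈ₚ.∈-upTo⁻ (proj₂ (∈ₚ.∈-cartesianProduct⁻ S (upTo D) vi∈)))) ⟩
    toℚ (length places) *ℚ L ^ℚ (5 ^ suc D ∸ 1)
      ≡⟨ cong (λ m → toℚ m *ℚ L ^ℚ (5 ^ suc D ∸ 1))
           (trans (length-cartesianProduct S (upTo D)) (cong (length S *_) (Listₚ.length-upTo D))) ⟩
    toℚ (length S * D) *ℚ L ^ℚ (5 ^ suc D ∸ 1) ∎
    where
    open ℚₚ.≤-Reasoning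
    places : List (Fin n × ℕ)
    places = cartesianProduct S (upTo D)
    at-place : Fin n × ℕ → List (Fin n) → Bool
    at-place (v , i) = has-at v i
    passing-count : Fin n × ℕ → ℕ
    passing-count (v , i) = count (passing v i) (seqs n D)
    located : ∀ mid → mid ∈ seqs n D → T (admissible-interior mid) → Any (λ b → T (at-place b mid)) places
    located mid mid∈ t with find (hits mid mid∈ t)
    ... | v , v∈mid , v∈S with ∈⇒place mid v∈mid
    ... | i , i< , at-i =
      lose (∈ₚ.∈-cartesianProduct⁺ v∈S (∈ₚ.∈-upTo⁺ (subst (i <_) (seqs-length n D mid mid∈) i<))) at-i

module GreedyPacking {X : Set} (_≟_ : DecidableEquality X) {P : List X → Set} (P? : Decidable P) where
  open import Data.List.Membership.DecPropositional _≟_ using (_∈?_)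

  greedy : List (List X) → List (List X) → List (List X)
  greedy kept []       = kept
  greedy kept (s ∷ ss) with P? s | any? (_∈? concat kept) s
  ... | yes _ | no _  = greedy (s ∷ kept) ss
  ... | yes _ | yes _ = greedy kept ss
  ... | no _  | _     = greedy kept ss

  greedy-packing : ∀ kept ss → AllPairs Disjoint kept → All P kept →
    AllPairs Disjoint (greedy kept ss) × All P (greedy kept ss)
  greedy-packing kept []       disjoint Ps = disjoint , Ps
  greedy-packing kept (s ∷ ss) disjoint Ps with P? s | any? (_∈? concat kept) s
  ... | yes Ps′ | no misses = greedy-packing (s ∷ kept) ss (All.tabulate disjoint-from ∷ disjoint) (Ps′ All.∷ Ps)
    where
    disjoint-from : ∀ {t} → t ∈ kept → Disjoint s t
    disjoint-from t∈ (z∈s , z∈t) = misses (lose z∈s (∈ₚ.∈-concat⁺′ z∈t t∈))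
  ... | yes _ | yes _ = greedy-packing kept ss disjoint Ps
  ... | no _  | _     = greedy-packing kept ss disjoint Ps

  greedy-⊆ : ∀ kept ss {s} → s ∈ greedy kept ss → s ∈ kept ⊎ s ∈ ss
  greedy-⊆ kept []       s∈ = inj₁ s∈
  greedy-⊆ kept (t ∷ ss) s∈ with P? t | any? (_∈? concat kept) t
  ... | yes _ | no _  with greedy-⊆ (t ∷ kept) ss s∈
  ...   | inj₁ (here refl) = inj₂ (here refl)
  ...   | inj₁ (there s∈k) = inj₁ s∈k
  ...   | inj₂ s∈ss        = inj₂ (there s∈ss)
  greedy-⊆ kept (t ∷ ss) s∈ | yes _ | yes _ = map₂ there (greedy-⊆ kept ss s∈)
  greedy-⊆ kept (t ∷ ss) s∈ | no _  | _     = map₂ there (greedy-⊆ kept ss s∈)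

  greedy-extends : ∀ kept ss {z} → z ∈ concat kept → z ∈ concat (greedy kept ss)
  greedy-extends kept []       z∈ = z∈
  greedy-extends kept (s ∷ ss) z∈ with P? s | any? (_∈? concat kept) s
  ... | yes _ | no _  = greedy-extends (s ∷ kept) ss (∈ₚ.∈-++⁺ʳ s z∈)
  ... | yes _ | yes _ = greedy-extends kept ss z∈
  ... | no _  | _     = greedy-extends kept ss z∈

  greedy-blocks : ∀ kept ss {s} → s ∈ ss → P s → ∃[ z ] (z ∈ s) → Any (_∈ concat (greedy kept ss)) s
  greedy-blocks kept (s ∷ ss) (here refl) Ps (z , z∈s) with P? s | any? (_∈? concat kept) s
  ... | yes _ | no _     = lose z∈s (greedy-extends (s ∷ kept) ss (∈ₚ.∈-++⁺ˡ z∈s))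
  ... | yes _ | yes hits = Any-map (greedy-extends kept ss) hits
  ... | no ¬Ps | _       = ⊥-elim (¬Ps Ps)
  greedy-blocks kept (t ∷ ss) (there s∈) Ps nonempty with P? t | any? (_∈? concat kept) t
  ... | yes _ | no _  = greedy-blocks (t ∷ kept) ss s∈ Ps nonempty
  ... | yes _ | yes _ = greedy-blocks kept ss s∈ Ps nonempty
  ... | no _  | _     = greedy-blocks kept ss s∈ Ps nonempty

lookup-disjoint : ∀ {X : Set} {F : List (List X)} → AllPairs Disjoint F → ∀ i j → i ≢ j → Disjoint (lookup F i) (lookup F j)
lookup-disjoint (d ∷ pw) Fin.zero    Fin.zero    i≢j = ⊥-elim (i≢j refl)
lookup-disjoint (d ∷ pw) Fin.zero    (Fin.suc j) _   = All.lookup d (∈ₚ.∈-lookup j)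
lookup-disjoint (d ∷ pw) (Fin.suc i) Fin.zero    _   = λ (z∈a , z∈b) → All.lookup d (∈ₚ.∈-lookup i) (z∈b , z∈a)
lookup-disjoint (d ∷ pw) (Fin.suc i) (Fin.suc j) i≢j = lookup-disjoint pw i j (λ eq → i≢j (cong Fin.suc eq))

length-concat-≤ : ∀ {A : Set} D (F : List (List A)) → (∀ s → s ∈ F → length s ≡ D) → length (concat F) ≤ length F * D
length-concat-≤ D []      _       = z≤n
length-concat-≤ D (s ∷ F) lengths = ℕₚ.≤-trans (ℕₚ.≤-reflexive (Listₚ.length-++ s))
  (ℕₚ.+-mono-≤ (ℕₚ.≤-reflexive (lengths s (here refl))) (length-concat-≤ D F (λ t t∈ → lengths t (there t∈))))

-- Assembling the three steps for fixed k ≥ 1 and h.  We want m = (h+2)(2k+1) + 1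
-- paths; fewer than m interiors of length D ≤ 2k cover at most C (vertex, place) pairs.
module Assembly (k : ℕ) (1≤k : 1 ≤ k) (h : ℕ) where

  m₀ m C : ℕ
  m₀ = (h + 2) * (2 * k + 1)
  m  = m₀ + 1
  C  = m₀ * (k + k) * (k + k)

  Conclusion : ∀ {n} → Graph n → (ℕ → Fin n) → Set
  Conclusion {n} G u = ∃[ α ] ∃[ β ] (1 ≤ α × α ≤ k × 1 ≤ β × β ≤ k × k < α + β ×
    Σ (Fin m → List (Fin n)) λ P →
      ((i : Fin m) → length (P i) ≡ α + β ∸ 1 × IsPath G (u (k ∸ α) ∷ P i ++ [ u (k + β) ])) ×
      ((i j : Fin m) → i ≢ j → (x : Fin n) → x ∈ P i → x ∈ P j → ⊥))

  packing⇒conclusion : ∀ {n} (G : Graph n) (u : ℕ → Fin n) a D → k < suc D → a + suc D ≤ k + k →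
    (F : List (List (Fin n))) → AllPairs Disjoint F →
    (∀ s → s ∈ F → length s ≡ D × T (isPathB G (u a ∷ s ++ [ u (suc a + D) ]))) →
    m ≤ length F → Conclusion G u
  packing⇒conclusion {n} G u a D long inside F disjoint valid m≤ =
    k ∸ a , a + suc D ∸ k , ℕₚ.m<n⇒0<n∸m a<k , ℕₚ.m∸n≤m k a ,
    ℕₚ.m<n⇒0<n∸m (ℕₚ.<-≤-trans long (ℕₚ.m≤n+m (suc D) a)) ,
    ℕₚ.≤-trans (ℕₚ.∸-monoˡ-≤ k inside) (ℕₚ.≤-reflexive (ℕₚ.m+n∸n≡m k k)) ,
    subst (k <_) (sym α+β) long , P , paths ,
    λ i j i≢j z z∈i z∈j → lookup-disjoint disjoint (pick i) (pick j)
                            (λ eq → i≢j (Finₚ.inject≤-injective m≤ m≤ i j eq)) (z∈i , z∈j)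
    where
    a<k : a < k
    a<k = ℕₚ.+-cancelʳ-< k a k (ℕₚ.≤-trans (ℕₚ.+-monoʳ-< a long) inside)
    k≤a+d : k ≤ a + suc D
    k≤a+d = ℕₚ.≤-trans (ℕₚ.<⇒≤ long) (ℕₚ.m≤n+m (suc D) a)
    α+β : k ∸ a + (a + suc D ∸ k) ≡ suc D
    α+β = begin
      k ∸ a + (a + suc D ∸ k)    ≡⟨ ℕₚ.+-comm (k ∸ a) _ ⟩
      (a + suc D ∸ k) + (k ∸ a)  ≡⟨ sym (ℕₚ.+-∸-assoc (a + suc D ∸ k) (ℕₚ.<⇒≤ a<k)) ⟩
      (a + suc D ∸ k) + k ∸ a    ≡⟨ cong (_∸ a) (ℕₚ.m∸n+n≡m k≤a+d) ⟩
      a + suc D ∸ a              ≡⟨ ℕₚ.m+n∸m≡n a (suc D) ⟩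
      suc D                      ∎
      where open ≡-Reasoning
    pick : Fin m → Fin (length F)
    pick i = Fin.inject≤ i m≤
    P : Fin m → List (Fin n)
    P i = lookup F (pick i)
    paths : (i : Fin m) → length (P i) ≡ k ∸ a + (a + suc D ∸ k) ∸ 1 ×
                          IsPath G (u (k ∸ (k ∸ a)) ∷ P i ++ [ u (k + (a + suc D ∸ k)) ])
    paths i = trans (proj₁ (valid (P i) (∈ₚ.∈-lookup (pick i)))) (cong (_∸ 1) (sym α+β)) ,
      subst₂ (λ p q → IsPath G (u p ∷ P i ++ [ u q ]))
        (sym (ℕₚ.m∸[m∸n]≡n (ℕₚ.<⇒≤ a<k))) (sym (trans (ℕₚ.m+[n∸m]≡n k≤a+d) (ℕₚ.+-suc a D)))
        (proj₂ (valid (P i) (∈ₚ.∈-lookup (pick i))))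

  module _ (L : ℚ) (1≤L : 1ℚ ≤ℚ L) (C≤L : toℚ C ≤ℚ L) {n : ℕ} (G : Graph n) (u : ℕ → Fin n) where
    open Goodness G L
    open Windows u

    few-admissible : ∀ D (x y : Fin n) → 1 ≤ D → D ≤ k + k → (F : List (List (Fin n))) → length F ≤ m₀ →
      (∀ s → s ∈ F → length s ≡ D) →
      (∀ mid → mid ∈ seqs n D → T (SplittingBound.admissible-interior G L 1≤L D x y mid) → Any (_∈ concat F) mid) →
      toℚ (count (SplittingBound.admissible-interior G L 1≤L D x y) (seqs n D)) ≤ℚ fbound (suc D) L
    few-admissible D x y 1≤D D≤ F few lengths hits = begin
      toℚ (count admissible-interior (seqs n D))          ≤⟨ count-hitting D (concat F) hits ⟩
      toℚ (length (concat F) * D) *ℚ L ^ℚ (E ∸ 1)         ≤⟨ ℚₚ.*-monoʳ-≤-nonNeg (L ^ℚ (E ∸ 1)) {{nonNegative (^ℚ-nonNeg (E ∸ 1))}}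
                                                               (ℚₚ.≤-trans (toℚ-mono pairs≤C) C≤L) ⟩
      L *ℚ L ^ℚ (E ∸ 1)                                    ≡⟨ cong (L ^ℚ_) (trans (ℕₚ.+-comm 1 (E ∸ 1)) (ℕₚ.m∸n+n≡m 1≤E)) ⟩
      L ^ℚ E                                               ∎
      where
      open ℚₚ.≤-Reasoning
      open SplittingBound G L 1≤L D x y
      open Powers L 1≤L
      E = 5 ^ suc D
      1≤E : 1 ≤ E
      1≤E = ℕₚ.^-monoʳ-≤ 5 {0} {suc D} z≤n
      pairs≤C : length (concat F) * D ≤ C
      pairs≤C = ℕₚ.*-mono-≤ (ℕₚ.≤-trans (length-concat-≤ D F lengths) (ℕₚ.*-mono-≤ few D≤)) D≤

    bad-window⇒conclusion : ∀ a D → k < suc D → a + suc D ≤ k + k →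
      fbound (suc D) L <ℚ toℚ (count (adm D) (sameEnds (window a (suc D)))) → Conclusion G u
    bad-window⇒conclusion a D long inside crowded = by-size (m ≤? length chosen)
      where
      x = u a
      y = u (suc a + D)
      open SplittingBound G L 1≤L D x y using (admissible-interior)
      open GreedyPacking Fin._≟_ (λ s → T? (admissible-interior s))
      1≤D : 1 ≤ D
      1≤D = ℕₚ.≤-pred (ℕₚ.≤-trans (s≤s 1≤k) long)
      D≤ : D ≤ k + k
      D≤ = ℕₚ.≤-trans (ℕₚ.n≤1+n D) (ℕₚ.≤-trans (ℕₚ.m≤n+m (suc D) a) inside)
      chosen = greedy [] (seqs n D)
      packing = greedy-packing [] (seqs n D) [] All.[]
      chosen-from : ∀ s → s ∈ chosen → s ∈ seqs n D
      chosen-from s s∈ with greedy-⊆ [] (seqs n D) s∈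
      ... | inj₂ s∈′ = s∈′
      interior-count : count (adm D) (sameEnds (window a (suc D))) ≡ count admissible-interior (seqs n D)
      interior-count = trans (count-map (adm D) _ (seqs n (length (window (suc a) D) ∸ 1)))
        (cong₂ (λ z ℓ → count (λ mid → adm D (x ∷ mid ++ [ z ])) (seqs n ℓ))
          (lastOr-window x (suc a) D) (cong (_∸ 1) (length-window (suc a) D)))
      by-size : Dec (m ≤ length chosen) → Conclusion G u
      by-size (yes m≤) = packing⇒conclusion G u a D long inside chosen (proj₁ packing)
        (λ s s∈ → seqs-length n D s (chosen-from s s∈) , adm⇒path D (x ∷ s ++ [ y ]) (All.lookup (proj₂ packing) s∈)) m≤
      by-size (no  m≰) = ⊥-elim (ℚₚ.<-irrefl refl (ℚₚ.<-≤-trans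
        (subst (λ c → fbound (suc D) L <ℚ toℚ c) interior-count crowded)
        (few-admissible D x y 1≤D D≤ chosen (ℕₚ.≤-pred (subst (suc (length chosen) ≤_) (ℕₚ.+-comm m₀ 1) (ℕₚ.≰⇒> m≰)))
          (λ s s∈ → seqs-length n D s (chosen-from s s∈))
          (λ mid mid∈ t → greedy-blocks [] (seqs n D) mid∈ t (inhabited mid (seqs-length n D mid mid∈))))))
        where
        inhabited : ∀ mid → length mid ≡ D → ∃[ z ] (z ∈ mid)
        inhabited []        eq = ⊥-elim (ℕₚ.n≮0 (subst (0 <_) (sym eq) 1≤D))
        inhabited (z ∷ mid) _  = z , here refl

lemma4p8 : (k : ℕ) → 1 ≤ k → (h : ℕ) →
    ∃[ L₀ ] ((L : ℚ) → L₀ ≤ℚ L → 0ℚ <ℚ L →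
      {n : ℕ} (G : Graph n) (u : ℕ → Fin n) →
      IsPath G (map u (upTo (suc (k + k)))) →
      ¬ IsGood G L (map u (upTo (suc (k + k)))) →
      ((i : ℕ) → i ≤ k → IsGood G L (map (λ j → u (i + j)) (upTo (suc k)))) →
      ∃[ α ] ∃[ β ] (1 ≤ α × α ≤ k × 1 ≤ β × β ≤ k × k < α + β ×
        Σ (Fin ((h + 2) * (2 * k + 1) + 1) → List (Fin n)) λ P →
          ((i : Fin ((h + 2) * (2 * k + 1) + 1)) →
            length (P i) ≡ α + β ∸ 1 ×
            IsPath G (u (k ∸ α) ∷ P i ++ [ u (k + β) ])) ×
          ((i j : Fin ((h + 2) * (2 * k + 1) + 1)) → i ≢ j →
            (x : Fin n) → x ∈ P i → x ∈ P j → ⊥)))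
lemma4p8 k 1≤k h = toℚ (suc C) , λ L L₀≤L _ {n} G u path not-good k-windows-good →
  let open Goodness G L
      open Windows u
      as-window : ∀ a d → IsGood G L (map (λ j → u (a + j)) (upTo (suc d))) ≡ T (good d (window a d))
      as-window a d = trans (cong (λ w → T (good (plen w) w)) (map-upTo≡window a d))
                            (cong (λ ℓ → T (good ℓ (window a d))) (plen-window a d))
      1≤L = ℚₚ.≤-trans (toℚ-mono {1} {suc C} (s≤s z≤n)) L₀≤L
      C≤L = ℚₚ.≤-trans (toℚ-mono (ℕₚ.n≤1+n C)) L₀≤L
      whole-path     = subst (λ w → T (isPathB G w)) (map-upTo≡window 0 (k + k)) path
      whole-not-good = λ good-window → not-good (subst (λ A → A) (sym (as-window 0 (k + k))) good-window)
      k-good         = λ i i≤k → subst (λ A → A) (as-window i k) (k-windows-good i i≤k)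
      bad = MinimalBadWindow.find-bad-window G L k 1≤k u k-good
              (k + k) 0 (k + k) ℕₚ.≤-refl (ℕₚ.≤-trans 1≤k (ℕₚ.m≤m+n k k)) ℕₚ.≤-refl whole-path whole-not-good
      open MinimalBadWindow.BadWindow bad
  in  bad-window⇒conclusion L 1≤L C≤L G u start len′ long inside crowded
  where open Assembly k 1≤k h
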